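{- Let $G$ be a graph and $k$ an integer. There is a set $F\subseteq E(G)$ with $|F|\le k$ such that $G/F$ is a biclique if and only if $V(G)$ has a $k$-constrained valid partition.
   Context: All graphs are finite, simple and undirected. Contracting an edge $uv$ replaces $u,v$ by a new vertex adjacent to $(N(u)\cup N(v))\setminus\{u,v\}$; $G/F$ is obtained by contracting all edges of $F$. A biclique is a bipartite graph with bipartition $\langle X,Y\rangle$ in which every vertex of $X$ is adjacent to every vertex of $Y$ (edgeless graphs included). For $S\subseteq V(G)$, $\mathsf{sf}(S)$ denotes the number of edges in a spanning forest of $G[S]$. A partition $\langle L,R\rangle$ of $V(G)$ into two parts is a $k$-constrained valid partition if (1) $\mathsf{sf}(L)+\mathsf{sf}(R)\le k$, and (2) every connected component of $G[L]$ is adjacent to (i.e. has an edge to) every connected component of $G[R]$. -}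

module Defs where

open import Data.Bool using (Bool; true; false)
open import Data.Nat using (ℕ; _≤_; _<_; _+_)
open import Data.Integer using (ℤ; +_) renaming (_≤_ to _≤ℤ_)
open import Data.Fin using (Fin; toℕ)
open import Data.List using (List; []; _∷_; _++_; length)
open import Data.List.Membership.Propositional using (_∈_)
open import Data.List.Relation.Unary.All using (All)
open import Data.List.Relation.Unary.Unique.Propositional using (Unique)
open import Data.List.Relation.Unary.Linked using (Linked)
open import Data.Product using (Σ; ∃; ∃-syntax; _×_; _,_)
open import Data.Sum using (_⊎_)
open import Relation.Nullary using (¬_)
open import Relation.Binary.PropositionalEquality using (_≡_; _≢_)
open import Relation.Binary.Construct.Closure.ReflexiveTransitive using (Star)
open import Function.Bundles using (_⇔_)

record Graph (n : ℕ) : Set where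
  field
    E     : Fin n → Fin n → Bool
    sym   : ∀ u v → E u v ≡ E v u
    irref : ∀ u → E u u ≡ false

module _ {n : ℕ} (G : Graph n) where
  open Graph G

  Adj : Fin n → Fin n → Set
  Adj u v = E u v ≡ true

  -- An edge set: a duplicate-free list of pairs (u , v) with u < v, each an edge of G.
  -- Its cardinality |F| is the length of the list.
  IsEdgeSet : List (Fin n × Fin n) → Set
  IsEdgeSet F = All (λ { (u , v) → (toℕ u < toℕ v) × Adj u v }) F × Unique F

  EdgeIn : List (Fin n × Fin n) → Fin n → Fin n → Set
  EdgeIn F u v = ((u , v) ∈ F) ⊎ ((v , u) ∈ F)

  -- The vertices of G/F are the connected components
  -- of the spanning subgraph (V(G), F); a vertex of G/F is represented
  -- by any vertex of G in that class.  Two distinct classes are adjacent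
  -- iff some edge of G joins them (loops disappear, parallel edges merge).

  SameClass : List (Fin n × Fin n) → Fin n → Fin n → Set
  SameClass F = Star (EdgeIn F)

  ContractAdj : List (Fin n × Fin n) → Fin n → Fin n → Set
  ContractAdj F u v =
    ¬ SameClass F u v ×
    ∃[ u' ] ∃[ v' ] (SameClass F u u' × SameClass F v v' × Adj u' v')

  -- G/F is a biclique: there is a bipartition ⟨X,Y⟩ of the vertices of G/F
  -- (side : class → Bool, X = true side, Y = false side; parts may be empty)
  -- such that two vertices of G/F are adjacent iff they lie in different parts.
  ContractionIsBiclique : List (Fin n × Fin n) → Set
  ContractionIsBiclique F =
    Σ (Fin n → Bool) λ side →
      (∀ u v → SameClass F u v → side u ≡ side v) ×
      (∀ u v → ContractAdj F u v ⇔ (side u ≢ side v))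

  AdjIn : (Fin n → Set) → Fin n → Fin n → Set
  AdjIn S u v = Adj u v × S u × S v

  ConnIn : (Fin n → Set) → Fin n → Fin n → Set
  ConnIn S = Star (AdjIn S)

  HasCycle : List (Fin n × Fin n) → Set
  HasCycle T =
    Σ (Fin n) λ v0 → Σ (List (Fin n)) λ vs → Σ (Fin n) λ w →
      (1 ≤ length vs) ×
      Unique (v0 ∷ (vs ++ (w ∷ []))) ×
      Linked (EdgeIn T) (v0 ∷ (vs ++ (w ∷ []))) ×
      EdgeIn T w v0

  IsSpanningForest : (Fin n → Set) → List (Fin n × Fin n) → Set
  IsSpanningForest S T =
    IsEdgeSet T ×
    All (λ { (u , v) → S u × S v }) T ×
    ¬ HasCycle T ×
    (∀ u v → AdjIn S u v → Star (EdgeIn T) u v)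

  -- k-constrained valid partition ⟨L,R⟩, given by side : V → Bool
  -- (L = vertices with side true, R = side false; parts may be empty).

  InL InR : (Fin n → Bool) → Fin n → Set
  InL side v = side v ≡ true
  InR side v = side v ≡ false

  -- sf(L) + sf(R) ≤ k, where sf(S) is the number of edges of a
  -- spanning forest of G[S] (independent of the chosen forest).
  SfCondition : ℤ → (Fin n → Bool) → Set
  SfCondition k side =
    Σ (List (Fin n × Fin n)) λ TL → Σ (List (Fin n × Fin n)) λ TR →
      IsSpanningForest (InL side) TL ×
      IsSpanningForest (InR side) TR ×
      (+ (length TL + length TR)) ≤ℤ k

  ComponentsAdjacent : (Fin n → Bool) → Set
  ComponentsAdjacent side =
    ∀ u v → InL side u → InR side v →
      ∃[ u' ] ∃[ v' ]
        (ConnIn (InL side) u u' × ConnIn (InR side) v v' × Adj u' v')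

  ValidPartition : ℤ → (Fin n → Bool) → Set
  ValidPartition k side = SfCondition k side × ComponentsAdjacent side

{-# OPTIONS --safe #-}
-- Given F, take a spanning forest T ⊆ F of the graph (V, F).  If G/F is a
-- biclique with sides ⟨L,R⟩, an edge of G inside one side joins two vertices
-- of the same F-class (otherwise the two classes would be adjacent on the
-- same side), so the edges of T lying in L, resp. R, are spanning forests of
-- G[L], resp. G[R], of total size |T| ≤ |F|; and adjacency of different
-- classes gives the edges between components of G[L] and G[R].  Conversely,
-- contracting the union of spanning forests of G[L] and G[R] collapses
-- exactly the components of G[L] and G[R], and the resulting graph is
-- the biclique with sides L and R.
module Submission where

open import Defs
open import Data.Nat using (ℕ; suc; _+_) renaming (_≤_ to _≤ℕ_)
open import Data.Nat.Properties using (+-suc; ≤-reflexive) renaming (≤-trans to ≤ℕ-trans)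
open import Data.Integer using (ℤ; +_; _≤_; +≤+)
open import Data.Integer.Properties using (≤-trans)
open import Data.Fin using (Fin; _≟_)
open import Data.Bool using (Bool; true; false) renaming (_≟_ to _≟ᵇ_)
open import Data.List using (List; []; _∷_; _++_; length; filter)
open import Data.List.Properties using (length-++)
open import Data.List.Membership.Propositional using (_∈_)
open import Data.List.Membership.Propositional.Properties
  using (∈-++⁺ˡ; ∈-++⁺ʳ; ∈-++⁻; ∈-filter⁺; ∈-filter⁻)
open import Data.List.Relation.Unary.Any using (here; there)
open import Data.List.Relation.Unary.All as All using (All; []; _∷_)
import Data.List.Relation.Unary.All.Properties as All
open import Data.List.Relation.Unary.AllPairs using ([]; _∷_)
open import Data.List.Relation.Unary.Unique.Propositional using (Unique)
import Data.List.Relation.Unary.Unique.Propositional.Properties as Unique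
open import Data.List.Relation.Unary.Linked as Linked using (Linked; []; [-]; _∷_)
open import Data.List.Relation.Binary.Sublist.Propositional
  using (_⊆_; _⊇_; []; _∷_; _∷ʳ_; lookup)
open import Data.List.Relation.Binary.Sublist.Propositional.Properties using (All-resp-⊆)
open import Data.List.Relation.Binary.Sublist.Heterogeneous.Properties using (length-mono-≤)
open import Data.Product using (Σ; _×_; _,_; proj₁; proj₂)
open import Data.Sum using (_⊎_; inj₁; inj₂; [_,_]′)
import Data.Sum as Sum
open import Data.Empty using (⊥-elim)
open import Function using (id; _∘_)
open import Function.Bundles using (_⇔_; mk⇔; Equivalence)
open import Relation.Binary.Core using (Rel)
open import Relation.Binary.Definitions using (_Respects_)
open import Relation.Nullary using (¬_; yes; no; contradiction)
open import Relation.Unary using (Pred)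
open import Relation.Binary.PropositionalEquality
  using (_≡_; _≢_; refl; sym; trans; cong)
open import Relation.Binary.Construct.Closure.ReflexiveTransitive
  using (Star; ε; _◅_; _◅◅_; fold; kleisliStar; reverse)
import Relation.Binary.Construct.Closure.ReflexiveTransitive as Star

module _ {i r b} {I : Set i} {R : Rel I r} {B : Set b} (f : I → B)
         (R-resp : ∀ {x y} → R x y → f x ≡ f y) where

  Star-resp : ∀ {x y} → Star R x y → f x ≡ f y
  Star-resp = fold (λ x y → f x ≡ f y) (trans ∘ R-resp) refl

  Linked-resp : ∀ x ys t → Linked R (x ∷ ys ++ t ∷ []) → f x ≡ f t
  Linked-resp x []       t (r ∷ [-]) = R-resp r
  Linked-resp x (y ∷ ys) t (r ∷ rs)  = trans (R-resp r) (Linked-resp y ys t rs)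

Star-restrict : ∀ {i r s p} {I : Set i} {R : Rel I r} {S : Rel I s} {P : Pred I p} →
                (∀ {x y} → R x y → P x → P y × S x y) →
                ∀ {x y} → Star R x y → P x → Star S x y
Star-restrict step ε        px = ε
Star-restrict step (r ◅ rs) px with step r px
... | py , s = s ◅ Star-restrict step rs py

Unique-resp-⊆ : ∀ {a} {A : Set a} → Unique {A = A} Respects _⊇_
Unique-resp-⊆ []         []         = []
Unique-resp-⊆ (_ ∷ʳ τ)   (_ ∷ u)    = Unique-resp-⊆ τ u
Unique-resp-⊆ (refl ∷ τ) (x∉ ∷ u)   = All-resp-⊆ τ x∉ ∷ Unique-resp-⊆ τ u

length-filter-true+false : ∀ {a} {A : Set a} (f : A → Bool) xs →
  length (filter (λ x → f x ≟ᵇ true) xs) + length (filter (λ x → f x ≟ᵇ false) xs)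
    ≡ length xs
length-filter-true+false f []       = refl
length-filter-true+false f (x ∷ xs) with f x
... | true  = cong suc (length-filter-true+false f xs)
... | false = trans (+-suc _ _) (cong suc (length-filter-true+false f xs))

true≢false : true ≢ false
true≢false ()

module _ {n : ℕ} (G : Graph n) where

  private
    V : Set
    V = Fin n

    Edge : Set
    Edge = V × V

  Adj-sym : ∀ {x y} → Adj G x y → Adj G y x
  Adj-sym {x} {y} = trans (Graph.sym G y x)

  EdgeIn-sym : ∀ {T x y} → EdgeIn G T x y → EdgeIn G T y x
  EdgeIn-sym = Sum.swap

  EdgeIn-mono : ∀ {S T} → (∀ {e} → e ∈ S → e ∈ T) → ∀ {x y} → EdgeIn G S x y → EdgeIn G T x y
  EdgeIn-mono S⊆T = Sum.map S⊆T S⊆T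

  EdgeIn-[] : ∀ {x y} → ¬ EdgeIn G [] x y
  EdgeIn-[] (inj₁ ())
  EdgeIn-[] (inj₂ ())

  EdgeIn⇒Adj : ∀ {T} → IsEdgeSet G T → ∀ {x y} → EdgeIn G T x y → Adj G x y
  EdgeIn⇒Adj (edges , _) (inj₁ m) = proj₂ (All.lookup edges m)
  EdgeIn⇒Adj (edges , _) (inj₂ m) = Adj-sym (proj₂ (All.lookup edges m))

  HasCycle-mono : ∀ {S T} → (∀ {e} → e ∈ S → e ∈ T) → HasCycle G S → HasCycle G T
  HasCycle-mono S⊆T (v₀ , vs , w , len , distinct , path , closing) =
    v₀ , vs , w , len , distinct , Linked.map (EdgeIn-mono S⊆T) path , EdgeIn-mono S⊆T closing

  ContractAdj-sym : ∀ {F u v} → ContractAdj G F u v → ContractAdj G F v u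
  ContractAdj-sym (¬uv , u′ , v′ , uu′ , vv′ , a) =
    ¬uv ∘ reverse EdgeIn-sym , v′ , u′ , vv′ , uu′ , Adj-sym a

  Joins : V → V → V → V → Set
  Joins u v x y = (x ≡ u × y ≡ v) ⊎ (x ≡ v × y ≡ u)

  EdgeIn-∷⁻ : ∀ {u v T x y} → EdgeIn G ((u , v) ∷ T) x y → Joins u v x y ⊎ EdgeIn G T x y
  EdgeIn-∷⁻ (inj₁ (here refl)) = inj₁ (inj₁ (refl , refl))
  EdgeIn-∷⁻ (inj₁ (there m))   = inj₂ (inj₁ m)
  EdgeIn-∷⁻ (inj₂ (here refl)) = inj₁ (inj₂ (refl , refl))
  EdgeIn-∷⁻ (inj₂ (there m))   = inj₂ (inj₂ m)

  EdgeIn-∷-resp : ∀ {a} {A : Set a} (f : V → A) {u v T} → f u ≡ f v →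
                  (∀ {x y} → EdgeIn G T x y → f x ≡ f y) →
                  ∀ {x y} → EdgeIn G ((u , v) ∷ T) x y → f x ≡ f y
  EdgeIn-∷-resp f fu≡fv T-resp e with EdgeIn-∷⁻ e
  ... | inj₁ (inj₁ (refl , refl)) = fu≡fv
  ... | inj₁ (inj₂ (refl , refl)) = sym fu≡fv
  ... | inj₂ e′                   = T-resp e′

  -- A cycle through the new edge uv would join v back to u along edges of T,
  -- on which c is constant.
  module _ {a} {A : Set a} (c : V → A) {T : List Edge}
           (T-resp : ∀ {x y} → EdgeIn G T x y → c x ≡ c y)
           {u v : V} (cu≢cv : c u ≢ c v) where

    private
      Endpoint : V → Set
      Endpoint p = p ≡ u ⊎ p ≡ v

      Step : V → V → Set
      Step x y = Joins u v x y ⊎ EdgeIn G T x y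

      new-crosses : ∀ {x y} → Joins u v x y → c x ≢ c y
      new-crosses (inj₁ (refl , refl)) = cu≢cv
      new-crosses (inj₂ (refl , refl)) = cu≢cv ∘ sym

      new-source : ∀ {x y} → Joins u v x y → Endpoint x
      new-source (inj₁ (x≡u , _)) = inj₁ x≡u
      new-source (inj₂ (x≡v , _)) = inj₂ x≡v

      new-target : ∀ {x y} → Joins u v x y → Endpoint y
      new-target (inj₁ (_ , y≡v)) = inj₂ y≡v
      new-target (inj₂ (_ , y≡u)) = inj₁ y≡u

      new-touches : ∀ {p x y} → Endpoint p → Joins u v x y → p ≡ x ⊎ p ≡ y
      new-touches (inj₁ refl) (inj₁ (refl , _)) = inj₁ refl
      new-touches (inj₁ refl) (inj₂ (_ , refl)) = inj₂ refl
      new-touches (inj₂ refl) (inj₁ (_ , refl)) = inj₂ refl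
      new-touches (inj₂ refl) (inj₂ (refl , _)) = inj₁ refl

      new-sym : ∀ {x y} → Joins u v x y → Joins u v y x
      new-sym (inj₁ (x≡u , y≡v)) = inj₂ (y≡v , x≡u)
      new-sym (inj₂ (x≡v , y≡u)) = inj₁ (y≡u , x≡v)

      new-functional : ∀ {x y z} → Joins u v x y → Joins u v x z → y ≡ z
      new-functional (inj₁ (refl , refl)) (inj₁ (_ , refl))   = refl
      new-functional (inj₁ (refl , refl)) (inj₂ (u≡v , _))    = ⊥-elim (cu≢cv (cong c u≡v))
      new-functional (inj₂ (refl , refl)) (inj₁ (v≡u , _))    = ⊥-elim (cu≢cv (cong c (sym v≡u)))
      new-functional (inj₂ (refl , refl)) (inj₂ (_ , refl))   = refl

      avoiding : ∀ {p zs} → Endpoint p → All (p ≢_) zs → Linked Step zs → Linked (EdgeIn G T) zs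
      avoiding end _                  []             = []
      avoiding end _                  [-]            = [-]
      avoiding end (p≢x ∷ p≢y ∷ _)    (inj₁ e ∷ _)   = ⊥-elim ([ p≢x , p≢y ]′ (new-touches end e))
      avoiding end (_ ∷ p∉)           (inj₂ r ∷ rs)  = r ∷ avoiding end p∉ rs

      old-or-crossing : ∀ s ys t → Unique (s ∷ ys ++ t ∷ []) → Linked Step (s ∷ ys ++ t ∷ []) →
                        Linked (EdgeIn G T) (s ∷ ys ++ t ∷ []) ⊎ c s ≢ c t
      old-or-crossing s []       t _          (inj₂ r ∷ [-]) = inj₁ (r ∷ [-])
      old-or-crossing s []       t _          (inj₁ e ∷ [-]) = inj₂ (new-crosses e)
      old-or-crossing s (y ∷ ys) t (_ ∷ uniq) (inj₂ r ∷ rs)  =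
        Sum.map (r ∷_) (λ cy≢ct cs≡ct → cy≢ct (trans (sym (T-resp r)) cs≡ct))
                (old-or-crossing y ys t uniq rs)
      old-or-crossing s (y ∷ ys) t (s∉ ∷ _)   (inj₁ e ∷ rs)  = inj₂ λ cs≡ct →
        new-crosses e (trans cs≡ct (sym (Linked-resp c T-resp y ys t (avoiding (new-source e) s∉ rs))))

    acyclic-∷ : ¬ HasCycle G T → ¬ HasCycle G ((u , v) ∷ T)
    acyclic-∷ acyclic (v₀ , vs , w , len , distinct , path , closing) with EdgeIn-∷⁻ closing
    ... | inj₂ r with old-or-crossing v₀ vs w distinct (Linked.map EdgeIn-∷⁻ path)
    ...   | inj₁ old       = acyclic (v₀ , vs , w , len , distinct , old , r)
    ...   | inj₂ cv₀≢cw    = cv₀≢cw (sym (T-resp r))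
    acyclic-∷ acyclic (v₀ , x₁ ∷ vs , w , _ , v₀∉ ∷ x₁∉ ∷ _ , path , _) | inj₁ e
      with Linked.map EdgeIn-∷⁻ path
    ... | inj₂ r ∷ rs =
      new-crosses e (sym (Linked-resp c T-resp v₀ (x₁ ∷ vs) w (r ∷ avoiding (new-target e) v₀∉ rs)))
    ... | inj₁ e₁ ∷ _ = All.lookup x₁∉ (∈-++⁺ʳ vs (here refl)) (new-functional e₁ (new-sym e))

  -- A union–find labelling: vertices share a label iff the forest joins them.
  record LabelledForest (F : List Edge) : Set where
    field
      label           : V → V
      forest          : List Edge
      forest⊆F        : forest ⊆ F
      acyclic         : ¬ HasCycle G forest
      forest-resp     : ∀ {x y} → EdgeIn G forest x y → label x ≡ label y
      F-resp          : ∀ {x y} → EdgeIn G F x y → label x ≡ label y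
      label-connected : ∀ {x y} → label x ≡ label y → Star (EdgeIn G forest) x y

  merge : V → V → V → V
  merge i j l with l ≟ j
  ... | yes _ = i
  ... | no  _ = l

  merge-≡ : ∀ {i j l} → l ≡ j → merge i j l ≡ i
  merge-≡ {j = j} {l} l≡j with l ≟ j
  ... | yes _   = refl
  ... | no  l≢j = contradiction l≡j l≢j

  merge-≢ : ∀ {i j l} → l ≢ j → merge i j l ≡ l
  merge-≢ {j = j} {l} l≢j with l ≟ j
  ... | yes l≡j = contradiction l≡j l≢j
  ... | no  _   = refl

  emptyForest : LabelledForest []
  emptyForest = record
    { label           = id
    ; forest          = []
    ; forest⊆F        = []
    ; acyclic         = λ { (_ , _ , _ , _ , _ , _ , e) → EdgeIn-[] e }
    ; forest-resp     = ⊥-elim ∘ EdgeIn-[]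
    ; F-resp          = ⊥-elim ∘ EdgeIn-[]
    ; label-connected = λ { refl → ε }
    }

  module _ {F : List Edge} {u v : V} (LF : LabelledForest F) where
    open LabelledForest LF

    skip-edge : label u ≡ label v → LabelledForest ((u , v) ∷ F)
    skip-edge lu≡lv = record
      { label           = label
      ; forest          = forest
      ; forest⊆F        = (u , v) ∷ʳ forest⊆F
      ; acyclic         = acyclic
      ; forest-resp     = forest-resp
      ; F-resp          = EdgeIn-∷-resp label lu≡lv F-resp
      ; label-connected = label-connected
      }

    add-edge : label u ≢ label v → LabelledForest ((u , v) ∷ F)
    add-edge lu≢lv = record
      { label           = label′
      ; forest          = (u , v) ∷ forest
      ; forest⊆F        = refl ∷ forest⊆F
      ; acyclic         = acyclic-∷ label forest-resp lu≢lv acyclic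
      ; forest-resp     = EdgeIn-∷-resp label′ merged (cong (merge (label u) (label v)) ∘ forest-resp)
      ; F-resp          = EdgeIn-∷-resp label′ merged (cong (merge (label u) (label v)) ∘ F-resp)
      ; label-connected = connected
      }
      where
      label′ : V → V
      label′ = merge (label u) (label v) ∘ label

      merged : label′ u ≡ label′ v
      merged = trans (merge-≢ lu≢lv) (sym (merge-≡ {l = label v} refl))

      grow : ∀ {x y} → Star (EdgeIn G forest) x y → Star (EdgeIn G ((u , v) ∷ forest)) x y
      grow = Star.map (EdgeIn-mono there)

      connected : ∀ {x y} → label′ x ≡ label′ y → Star (EdgeIn G ((u , v) ∷ forest)) x y
      -- Abstracting over the two tests also unfolds merge in eq.
      connected {x} {y} eq with label x ≟ label v | label y ≟ label v
      ... | yes lx≡lv | yes ly≡lv = grow (label-connected (trans lx≡lv (sym ly≡lv)))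
      ... | yes lx≡lv | no  _     =
        grow (label-connected lx≡lv) ◅◅ inj₂ (here refl) ◅ grow (label-connected eq)
      ... | no  _     | yes ly≡lv =
        grow (label-connected eq) ◅◅ inj₁ (here refl) ◅ grow (label-connected (sym ly≡lv))
      ... | no  _     | no  _     = grow (label-connected eq)

  labelledForest : (F : List Edge) → LabelledForest F
  labelledForest []            = emptyForest
  labelledForest ((u , v) ∷ F) with LF ← labelledForest F
                               | LabelledForest.label LF u ≟ LabelledForest.label LF v
  ... | yes lu≡lv = skip-edge LF lu≡lv
  ... | no  lu≢lv = add-edge LF lu≢lv

  module FromBiclique {F : List Edge} (F-edges : IsEdgeSet G F) (side : V → Bool)
           (side-resp : ∀ u v → SameClass G F u v → side u ≡ side v)
           (adj⇔ : ∀ u v → ContractAdj G F u v ⇔ (side u ≢ side v)) where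

    open LabelledForest (labelledForest F)

    F-side : ∀ {x y} → EdgeIn G F x y → side x ≡ side y
    F-side e = side-resp _ _ (e ◅ ε)

    forest-side : ∀ {x y} → EdgeIn G forest x y → side x ≡ side y
    forest-side = F-side ∘ EdgeIn-mono (lookup forest⊆F)

    -- Otherwise u and v lie in different F-classes that are adjacent in G/F.
    same-side-edge-in-forest : ∀ {u v} → Adj G u v → side u ≡ side v → Star (EdgeIn G forest) u v
    same-side-edge-in-forest {u} {v} a su≡sv with label u ≟ label v
    ... | yes lu≡lv = label-connected lu≡lv
    ... | no  lu≢lv =
      ⊥-elim (Equivalence.to (adj⇔ u v) (lu≢lv ∘ Star-resp label F-resp , u , v , ε , ε , a) su≡sv)

    sideForest : Bool → List Edge
    sideForest b = filter (λ e → side (proj₁ e) ≟ᵇ b) forest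

    sideForest-spanning : ∀ b → IsSpanningForest G (λ x → side x ≡ b) (sideForest b)
    sideForest-spanning b =
      ( All.filter⁺ P? (All-resp-⊆ forest⊆F (proj₁ F-edges))
      , Unique.filter⁺ P? (Unique-resp-⊆ forest⊆F (proj₂ F-edges)) )
      , All.tabulate ends-on-side
      , acyclic ∘ HasCycle-mono (proj₁ ∘ ∈-filter⁻ P?)
      , λ x y (a , sx , sy) → Star-restrict stays (same-side-edge-in-forest a (trans sx (sym sy))) sx
      where
      P? = λ (e : Edge) → side (proj₁ e) ≟ᵇ b

      ends-on-side : ∀ {e} → e ∈ sideForest b → side (proj₁ e) ≡ b × side (proj₂ e) ≡ b
      ends-on-side m with ∈-filter⁻ P? m
      ... | m′ , sx = sx , trans (sym (forest-side (inj₁ m′))) sx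

      stays : ∀ {x y} → EdgeIn G forest x y → side x ≡ b → side y ≡ b × EdgeIn G (sideForest b) x y
      stays e sx = sy , Sum.map (λ m → ∈-filter⁺ P? m sx) (λ m → ∈-filter⁺ P? m sy) e
        where
        sy = trans (sym (forest-side e)) sx

    sideForests-size : length (sideForest true) + length (sideForest false) ≤ℕ length F
    sideForests-size = ≤ℕ-trans (≤-reflexive (length-filter-true+false (side ∘ proj₁) forest))
                                (length-mono-≤ forest⊆F)

    class-within-side : ∀ {b x y} → SameClass G F x y → side x ≡ b → ConnIn G (λ z → side z ≡ b) x y
    class-within-side = Star-restrict λ e sx →
      let sy = trans (sym (F-side e)) sx in sy , EdgeIn⇒Adj F-edges e , sx , sy

    components-adjacent : ComponentsAdjacent G side
    components-adjacent u v su sv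
      with Equivalence.from (adj⇔ u v) (λ su≡sv → true≢false (trans (sym su) (trans su≡sv sv)))
    ... | _ , u′ , v′ , uu′ , vv′ , a = u′ , v′ , class-within-side uu′ su , class-within-side vv′ sv , a

    validPartition : ∀ {k} → + length F ≤ k → ValidPartition G k side
    validPartition |F|≤k =
      ( sideForest true , sideForest false , sideForest-spanning true , sideForest-spanning false
      , ≤-trans (+≤+ sideForests-size) |F|≤k )
      , components-adjacent

  spanning-inside : ∀ {S T} → IsSpanningForest G S T → ∀ {x y} → (x , y) ∈ T → S x × S y
  spanning-inside (_ , inside , _) = All.lookup inside

  spanning-connects : ∀ {S T} → IsSpanningForest G S T →
                      ∀ {x y} → ConnIn G S x y → Star (EdgeIn G T) x y
  spanning-connects (_ , _ , _ , spans) = kleisliStar id (spans _ _)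

  module FromPartition (side : V → Bool) {TL TR : List Edge}
           (TL-forest : IsSpanningForest G (InL G side) TL)
           (TR-forest : IsSpanningForest G (InR G side) TR)
           (components-adjacent : ComponentsAdjacent G side) where

    F : List Edge
    F = TL ++ TR

    spanning-side : ∀ {b T} → IsSpanningForest G (λ z → side z ≡ b) T →
                    ∀ {x y} → (x , y) ∈ T → side x ≡ side y
    spanning-side forest m with spanning-inside forest m
    ... | sx , sy = trans sx (sym sy)

    F-side : ∀ {x y} → EdgeIn G F x y → side x ≡ side y
    F-side = [ member-side , sym ∘ member-side ]′
      where
      member-side : ∀ {x y} → (x , y) ∈ F → side x ≡ side y
      member-side m = [ spanning-side TL-forest , spanning-side TR-forest ]′ (∈-++⁻ TL m)

    class-side : ∀ {x y} → SameClass G F x y → side x ≡ side y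
    class-side = Star-resp side F-side

    edgeSet : IsEdgeSet G F
    edgeSet = union (proj₁ TL-forest) (proj₁ TR-forest)
      where
      disjoint : ∀ {e} → ¬ (e ∈ TL × e ∈ TR)
      disjoint (mL , mR) =
        true≢false (trans (sym (proj₁ (spanning-inside TL-forest mL)))
                          (proj₁ (spanning-inside TR-forest mR)))

      union : IsEdgeSet G TL → IsEdgeSet G TR → IsEdgeSet G F
      union (edgesL , uniqueL) (edgesR , uniqueR) =
        All.++⁺ edgesL edgesR , Unique.++⁺ uniqueL uniqueR disjoint

    F-length≤ : ∀ {k} → + (length TL + length TR) ≤ k → + length F ≤ k
    F-length≤ rewrite length-++ TL {TR} = id

    conn⇒class : ∀ b {x y} → ConnIn G (λ z → side z ≡ b) x y → SameClass G F x y
    conn⇒class true  = Star.map (EdgeIn-mono ∈-++⁺ˡ) ∘ spanning-connects TL-forest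
    conn⇒class false = Star.map (EdgeIn-mono (∈-++⁺ʳ TL)) ∘ spanning-connects TR-forest

    same-side-not-adjacent : ∀ u v → ContractAdj G F u v → side u ≢ side v
    same-side-not-adjacent u v (¬uv , u′ , v′ , uu′ , vv′ , a) su≡sv =
      ¬uv (uu′ ◅◅ conn⇒class (side u′) ((a , refl , sym su′≡sv′) ◅ ε) ◅◅ reverse EdgeIn-sym vv′)
      where
      su′≡sv′ : side u′ ≡ side v′
      su′≡sv′ = trans (sym (class-side uu′)) (trans su≡sv (class-side vv′))

    crossing-adjacent : ∀ {u v} → InL G side u → InR G side v → ContractAdj G F u v
    crossing-adjacent {u} {v} su sv with components-adjacent u v su sv
    ... | u′ , v′ , uu′ , vv′ , a =
      (λ uv → true≢false (trans (sym su) (trans (class-side uv) sv))) ,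
      u′ , v′ , conn⇒class true uu′ , conn⇒class false vv′ , a

    different-sides-adjacent : ∀ u v → side u ≢ side v → ContractAdj G F u v
    different-sides-adjacent u v su≢sv with side u in su | side v in sv
    ... | true  | false = crossing-adjacent su sv
    ... | false | true  = ContractAdj-sym (crossing-adjacent sv su)
    ... | true  | true  = contradiction refl su≢sv
    ... | false | false = contradiction refl su≢sv

    biclique : ContractionIsBiclique G F
    biclique = side , (λ _ _ → class-side) ,
               λ u v → mk⇔ (same-side-not-adjacent u v) (different-sides-adjacent u v)

lemma2 : ∀ {n : ℕ} (G : Graph n) (k : ℤ) →
    (Σ (List (Fin n × Fin n)) λ F →
    IsEdgeSet G F × (+ (length F)) ≤ k × ContractionIsBiclique G F)
    ⇔ (Σ (Fin n → Bool) λ side → ValidPartition G k side)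
lemma2 G k = mk⇔
  (λ { (F , F-edges , |F|≤k , side , side-resp , adj⇔) →
       side , FromBiclique.validPartition G F-edges side side-resp adj⇔ |F|≤k })
  (λ { (side , (TL , TR , TL-forest , TR-forest , size≤k) , adjacent) →
       let open FromPartition G side TL-forest TR-forest adjacent
       in F , edgeSet , F-length≤ size≤k , biclique })
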